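{- Let $t_1,t_2,E$ be terms and $a$ a term variable. For every $k\in\mathbb N$, if $t_1\equiv_k t_2$ then $E[a:=t_1]\equiv_k E[a:=t_2]$.
   Context: Fix pairwise disjoint countably infinite sets of $\lambda$-variables ($x,y,\dots$), stack variables ($\alpha,\beta,\dots$), term variables ($a,b,\dots$), and countable sets of labels $l$ and constructors $C$. Values, terms, stacks, processes: $v,w::=x\mid\lambda x\,t\mid C[v]\mid\{l_i=v_i\}_{i\in I}$; $t,u::=a\mid v\mid t\,u\mid\mu\alpha\,t\mid p\mid v.l\mid\mathrm{case}_v[C_i[x_i]\to t_i]_{i\in I}\mid\delta_{v,w}$; $\pi::=\alpha\mid v.\pi\mid[t]\pi$; $p::=t\ast\pi$; $I$ finite; $\lambda x$, $\mu\alpha$ and the $x_i$ in case branches are binders, term variables are never bound. Substitutions map $\lambda$-variables to values, stack variables to stacks, term variables to terms (capture-avoiding). $\succ$ is the smallest relation on processes with: $t\,u\ast\pi\succ u\ast[t]\pi$; $v\ast[t]\pi\succ t\ast v.\pi$; $\lambda x\,t\ast v.\pi\succ t[x:=v]\ast\pi$; $\mu\alpha\,t\ast\pi\succ t[\alpha:=\pi]\ast\pi$; $p\ast\pi\succ p$; $\{l_i=v_i\}_{i\in I}.l_k\ast\pi\succ v_k\ast\pi$ ($k\in I$); $\mathrm{case}_{C_k[v]}[C_i[x_i]\to t_i]_{i\in I}\ast\pi\succ t_k[x_k:=v]\ast\pi$ ($k\in I$). A process is final if it is $v\ast\alpha$ with $v$ a value and $\alpha$ a stack variable; for a relation $R$,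 $p\Downarrow_R$ means $p\,R^*\,q$ with $q$ final. For $i\in\mathbb N$, inductively: $\rightsquigarrow_i=\succ\cup\{(\delta_{v,w}\ast\pi,v\ast\pi)\mid\exists j<i,\ v\not\equiv_jw\}$; $t\equiv_iu$ iff for all $j\le i$, stacks $\pi$, substitutions $\sigma$: $t\sigma\ast\pi\Downarrow_{\rightsquigarrow_j}\Leftrightarrow u\sigma\ast\pi\Downarrow_{\rightsquigarrow_j}$; $\not\equiv_i$ is its negation. -}

module Defs where

open import Data.Nat using (ℕ; zero; suc)
open import Data.Fin using (Fin)
open import Data.Empty using (⊥)
open import Data.Sum using (_⊎_)
open import Data.Product using (_×_)
open import Relation.Nullary using (¬_)
open import Relation.Binary.Construct.Closure.ReflexiveTransitive using (Star)
open import Relation.Binary.PropositionalEquality using (_≡_)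
import Data.Nat
import Relation.Nullary
import Data.Unit
import Data.Product

-- Syntax.  λ-variables and stack variables are de Bruijn indices
-- (index ≥ binder depth = free variable; ℕ is countably infinite).
-- Term variables are never bound, so they are just names a : ℕ.
-- Labels and constructors are natural numbers (countable sets).
-- A finite index set I is Fin n; families indexed by I are functions.

Label Cons LVar SVar TVar : Set
Label = ℕ
Cons  = ℕ
LVar  = ℕ
SVar  = ℕ
TVar  = ℕ

data Val   : Set
data Term  : Set
data Stack : Set
data Proc  : Set

data Val where
  var : LVar → Val
  lam : Term → Val                                    -- λx t  (binds index 0)
  con : Cons → Val → Val
  rec : (n : ℕ) → (Fin n → Label) → (Fin n → Val) → Val

data Term where
  tvar  : TVar → Term
  val   : Val → Term
  app   : Term → Term → Term
  mu    : Term → Term                                 -- μα t  (binds stack index 0)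
  proc  : Proc → Term
  proj  : Val → Label → Term
  case  : Val → (n : ℕ) → (Fin n → Cons) → (Fin n → Term) → Term
        -- case_v [C_i[x_i] → t_i]_{i∈I}; each t_i binds λ-index 0
  delta : Val → Val → Term

data Stack where
  svar  : SVar → Stack
  push  : Val → Stack → Stack
  frame : Term → Stack → Stack

data Proc where
  _∗_ : Term → Stack → Proc

infix 4 _∗_

record Ren : Set where
  field
    lr : LVar → LVar
    sr : SVar → SVar
open Ren public

extN : (ℕ → ℕ) → ℕ → ℕ
extN f zero    = zero
extN f (suc n) = suc (f n)

renV : Ren → Val → Val
renT : Ren → Term → Term
renS : Ren → Stack → Stack
renP : Ren → Proc → Proc

renLam : Ren → Ren
renLam ρ = record { lr = extN (lr ρ) ; sr = sr ρ }

renMu : Ren → Ren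
renMu ρ = record { lr = lr ρ ; sr = extN (sr ρ) }

renV ρ (var x)       = var (lr ρ x)
renV ρ (lam t)       = lam (renT (renLam ρ) t)
renV ρ (con c v)     = con c (renV ρ v)
renV ρ (rec n ls vs) = rec n ls (λ i → renV ρ (vs i))

renT ρ (tvar a)         = tvar a
renT ρ (val v)          = val (renV ρ v)
renT ρ (app t u)        = app (renT ρ t) (renT ρ u)
renT ρ (mu t)           = mu (renT (renMu ρ) t)
renT ρ (proc p)         = proc (renP ρ p)
renT ρ (proj v l)       = proj (renV ρ v) l
renT ρ (case v n cs ts) = case (renV ρ v) n cs (λ i → renT (renLam ρ) (ts i))
renT ρ (delta v w)      = delta (renV ρ v) (renV ρ w)

renS ρ (svar α)    = svar (sr ρ α)
renS ρ (push v π)  = push (renV ρ v) (renS ρ π)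
renS ρ (frame t π) = frame (renT ρ t) (renS ρ π)

renP ρ (t ∗ π) = renT ρ t ∗ renS ρ π

wkL : Ren
wkL = record { lr = suc ; sr = λ α → α }

wkS : Ren
wkS = record { lr = λ x → x ; sr = suc }

record Subst : Set where
  field
    lv : LVar → Val
    sv : SVar → Stack
    tv : TVar → Term
open Subst public

liftLam : Subst → Subst
liftLam σ = record
  { lv = λ { zero → var zero ; (suc x) → renV wkL (lv σ x) }
  ; sv = λ α → renS wkL (sv σ α)
  ; tv = λ a → renT wkL (tv σ a) }

liftMu : Subst → Subst
liftMu σ = record
  { lv = λ x → renV wkS (lv σ x)
  ; sv = λ { zero → svar zero ; (suc α) → renS wkS (sv σ α) }
  ; tv = λ a → renT wkS (tv σ a) }

subV : Subst → Val → Val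
subT : Subst → Term → Term
subS : Subst → Stack → Stack
subP : Subst → Proc → Proc

subV σ (var x)       = lv σ x
subV σ (lam t)       = lam (subT (liftLam σ) t)
subV σ (con c v)     = con c (subV σ v)
subV σ (rec n ls vs) = rec n ls (λ i → subV σ (vs i))

subT σ (tvar a)         = tv σ a
subT σ (val v)          = val (subV σ v)
subT σ (app t u)        = app (subT σ t) (subT σ u)
subT σ (mu t)           = mu (subT (liftMu σ) t)
subT σ (proc p)         = proc (subP σ p)
subT σ (proj v l)       = proj (subV σ v) l
subT σ (case v n cs ts) = case (subV σ v) n cs (λ i → subT (liftLam σ) (ts i))
subT σ (delta v w)      = delta (subV σ v) (subV σ w)

subS σ (svar α)    = sv σ α
subS σ (push v π)  = push (subV σ v) (subS σ π)
subS σ (frame t π) = frame (subT σ t) (subS σ π)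

subP σ (t ∗ π) = subT σ t ∗ subS σ π

idSubst : Subst
idSubst = record { lv = var ; sv = svar ; tv = tvar }

_[0:=_] : Term → Val → Term
t [0:= v ] = subT (record idSubst { lv = λ { zero → v ; (suc x) → var x } }) t

_[0:=ˢ_] : Term → Stack → Term
t [0:=ˢ π ] = subT (record idSubst { sv = λ { zero → π ; (suc α) → svar α } }) t

updT : TVar → Term → TVar → Term
updT a t b with Data.Nat._≟_ a b
... | Relation.Nullary.yes _ = t
... | Relation.Nullary.no  _ = tvar b

_[_:=ᵗ_] : Term → TVar → Term → Term
E [ a :=ᵗ t ] = subT (record idSubst { tv = updT a t }) E

infix 4 _≻_
data _≻_ : Proc → Proc → Set where
  ≻app  : ∀ {t u π} → (app t u ∗ π) ≻ (u ∗ frame t π)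
  ≻val  : ∀ {v t π} → (val v ∗ frame t π) ≻ (t ∗ push v π)
  ≻lam  : ∀ {t v π} → (val (lam t) ∗ push v π) ≻ (t [0:= v ] ∗ π)
  ≻mu   : ∀ {t π} → (mu t ∗ π) ≻ (t [0:=ˢ π ] ∗ π)
  ≻proc : ∀ {p π} → (proc p ∗ π) ≻ p
  ≻proj : ∀ {n ls vs π} (k : Fin n) → (proj (rec n ls vs) (ls k) ∗ π) ≻ (val (vs k) ∗ π)
  ≻case : ∀ {n cs ts v π} (k : Fin n) →
          (case (con (cs k) v) n cs ts ∗ π) ≻ (ts k [0:= v ] ∗ π)

Final : Proc → Set
Final (val v ∗ svar α) = Data.Unit.⊤
Final _ = ⊥

Halts : (Proc → Proc → Set) → Proc → Set
Halts R p = Data.Product.Σ Proc (λ q → Star R p q × Final q)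

data Step (D : Val → Val → Set) : Proc → Proc → Set where
  base  : ∀ {p q} → p ≻ q → Step D p q
  δstep : ∀ {v w π} → D v w → Step D (delta v w ∗ π) (val v ∗ π)

Conv : (Val → Val → Set) → Term → Term → Set
Conv D t u = (π : Stack) (σ : Subst) →
  (Halts (Step D) (subT σ t ∗ π) → Halts (Step D) (subT σ u ∗ π)) ×
  (Halts (Step D) (subT σ u ∗ π) → Halts (Step D) (subT σ t ∗ π))

-- Dist i v w  :=  ∃ j < i. v ≢_j w      (so ⇝_i = Step (Dist i))
-- Equiv i t u :=  t ≡_i u  =  ∀ j ≤ i. Conv (Dist j) t u
-- Both written cumulatively so that the mutual recursion is structural.
Dist  : ℕ → Val → Val → Set
Equiv : ℕ → Term → Term → Set

Dist zero    v w = ⊥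
Dist (suc i) v w = Dist i v w ⊎ ¬ Equiv i (val v) (val w)

Equiv zero    t u = Conv (Dist zero) t u
Equiv (suc i) t u = Equiv i t u × Conv (Dist (suc i)) t u

_⇝[_]_ : Proc → ℕ → Proc → Set
p ⇝[ i ] q = Step (Dist i) p q

_≡[_]_ : Term → ℕ → Term → Set
t ≡[ i ] u = Equiv i t u

module Submission where

-- Fix t₁, t₂ and call two pieces of syntax related, u₁ ~ u₂,
-- when u₂ arises from u₁ by replacing (possibly nested) instances t₁τ₁ of
-- t₁ by instances t₂τ₂ of t₂, where τ₁ ~ τ₂ pointwise.  Since
-- E[a:=t₁] ~ E[a:=t₂], the lemma follows from the replacement theorem:
-- t₁ ≡ᵢ t₂ implies u₁ ≡ᵢ u₂ whenever u₁ ~ u₂.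
--
-- The replacement theorem rests on a simulation: if the δ-predicate D is
-- preserved by ~ and halting of t₁τ ∗ π implies halting of t₂τ ∗ π, then
-- halting transfers along ~.  Away from holes both sides make the same step;
-- at a hole, t₁τ₁ ∗ π₁ is simulated by t₁τ₂ ∗ π₂ (fewer steps remain, or
-- the hole is a smaller one), and the hypothesis moves on to t₂τ₂ ∗ π₂.
-- The δ-predicate of ⇝ᵢ (v ≢ⱼ w for some j < i) is preserved by ~ thanks to
-- the theorem at lower levels, so the theorem is proved by induction on i.
--
-- Records and case analyses carry functions out of Fin n, so equations
-- between substituted syntax hold only pointwise.

open import Defs
open import Data.Nat using (ℕ; zero; suc; _≟_)
open import Data.Empty using (⊥)
open import Data.Unit using (⊤; tt)
open import Data.Sum using (_⊎_; inj₁; inj₂)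
open import Data.Product using (∃; _×_; _,_; proj₁; proj₂)
open import Relation.Nullary using (yes; no)
open import Relation.Binary.PropositionalEquality using (_≡_; refl; cong)
open import Relation.Binary.Construct.Closure.ReflexiveTransitive using (ε; _◅_)

infix 4 _≈ᵛ_ _≈ᵗ_ _≈ˢ_ _≈ᵖ_

data _≈ᵛ_ : Val → Val → Set
data _≈ᵗ_ : Term → Term → Set
data _≈ˢ_ : Stack → Stack → Set
data _≈ᵖ_ : Proc → Proc → Set

data _≈ᵛ_ where
  ≈var : ∀ x → var x ≈ᵛ var x
  ≈lam : ∀ {t t'} → t ≈ᵗ t' → lam t ≈ᵛ lam t'
  ≈con : ∀ c {v v'} → v ≈ᵛ v' → con c v ≈ᵛ con c v'
  ≈rec : ∀ n ls {f g} → (∀ i → f i ≈ᵛ g i) → rec n ls f ≈ᵛ rec n ls g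

data _≈ᵗ_ where
  ≈tvar  : ∀ a → tvar a ≈ᵗ tvar a
  ≈val   : ∀ {v v'} → v ≈ᵛ v' → val v ≈ᵗ val v'
  ≈app   : ∀ {t t' u u'} → t ≈ᵗ t' → u ≈ᵗ u' → app t u ≈ᵗ app t' u'
  ≈mu    : ∀ {t t'} → t ≈ᵗ t' → mu t ≈ᵗ mu t'
  ≈proc  : ∀ {p p'} → p ≈ᵖ p' → proc p ≈ᵗ proc p'
  ≈proj  : ∀ {v v'} → v ≈ᵛ v' → ∀ l → proj v l ≈ᵗ proj v' l
  ≈case  : ∀ {v v'} → v ≈ᵛ v' → ∀ n cs {f g} → (∀ i → f i ≈ᵗ g i) →
           case v n cs f ≈ᵗ case v' n cs g
  ≈delta : ∀ {v v' w w'} → v ≈ᵛ v' → w ≈ᵛ w' → delta v w ≈ᵗ delta v' w'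

data _≈ˢ_ where
  ≈svar  : ∀ α → svar α ≈ˢ svar α
  ≈push  : ∀ {v v' π π'} → v ≈ᵛ v' → π ≈ˢ π' → push v π ≈ˢ push v' π'
  ≈frame : ∀ {t t' π π'} → t ≈ᵗ t' → π ≈ˢ π' → frame t π ≈ˢ frame t' π'

data _≈ᵖ_ where
  _≈∗_ : ∀ {t t' π π'} → t ≈ᵗ t' → π ≈ˢ π' → (t ∗ π) ≈ᵖ (t' ∗ π')

≈ᵛ-refl : ∀ v → v ≈ᵛ v
≈ᵗ-refl : ∀ t → t ≈ᵗ t
≈ˢ-refl : ∀ π → π ≈ˢ π
≈ᵖ-refl : ∀ p → p ≈ᵖ p
≈ᵛ-refl (var x)      = ≈var x
≈ᵛ-refl (lam t)      = ≈lam (≈ᵗ-refl t)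
≈ᵛ-refl (con c v)    = ≈con c (≈ᵛ-refl v)
≈ᵛ-refl (rec n ls f) = ≈rec n ls (λ i → ≈ᵛ-refl (f i))
≈ᵗ-refl (tvar a)        = ≈tvar a
≈ᵗ-refl (val v)         = ≈val (≈ᵛ-refl v)
≈ᵗ-refl (app t u)       = ≈app (≈ᵗ-refl t) (≈ᵗ-refl u)
≈ᵗ-refl (mu t)          = ≈mu (≈ᵗ-refl t)
≈ᵗ-refl (proc p)        = ≈proc (≈ᵖ-refl p)
≈ᵗ-refl (proj v l)      = ≈proj (≈ᵛ-refl v) l
≈ᵗ-refl (case v n cs f) = ≈case (≈ᵛ-refl v) n cs (λ i → ≈ᵗ-refl (f i))
≈ᵗ-refl (delta v w)     = ≈delta (≈ᵛ-refl v) (≈ᵛ-refl w)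
≈ˢ-refl (svar α)    = ≈svar α
≈ˢ-refl (push v π)  = ≈push (≈ᵛ-refl v) (≈ˢ-refl π)
≈ˢ-refl (frame t π) = ≈frame (≈ᵗ-refl t) (≈ˢ-refl π)
≈ᵖ-refl (t ∗ π) = ≈ᵗ-refl t ≈∗ ≈ˢ-refl π

≈ᵛ-sym : ∀ {v v'} → v ≈ᵛ v' → v' ≈ᵛ v
≈ᵗ-sym : ∀ {t t'} → t ≈ᵗ t' → t' ≈ᵗ t
≈ˢ-sym : ∀ {π π'} → π ≈ˢ π' → π' ≈ˢ π
≈ᵖ-sym : ∀ {p p'} → p ≈ᵖ p' → p' ≈ᵖ p
≈ᵛ-sym (≈var x)      = ≈var x
≈ᵛ-sym (≈lam d)      = ≈lam (≈ᵗ-sym d)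
≈ᵛ-sym (≈con c d)    = ≈con c (≈ᵛ-sym d)
≈ᵛ-sym (≈rec n ls f) = ≈rec n ls (λ i → ≈ᵛ-sym (f i))
≈ᵗ-sym (≈tvar a)        = ≈tvar a
≈ᵗ-sym (≈val d)         = ≈val (≈ᵛ-sym d)
≈ᵗ-sym (≈app d e)       = ≈app (≈ᵗ-sym d) (≈ᵗ-sym e)
≈ᵗ-sym (≈mu d)          = ≈mu (≈ᵗ-sym d)
≈ᵗ-sym (≈proc d)        = ≈proc (≈ᵖ-sym d)
≈ᵗ-sym (≈proj d l)      = ≈proj (≈ᵛ-sym d) l
≈ᵗ-sym (≈case d n cs f) = ≈case (≈ᵛ-sym d) n cs (λ i → ≈ᵗ-sym (f i))
≈ᵗ-sym (≈delta d e)     = ≈delta (≈ᵛ-sym d) (≈ᵛ-sym e)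
≈ˢ-sym (≈svar α)    = ≈svar α
≈ˢ-sym (≈push d e)  = ≈push (≈ᵛ-sym d) (≈ˢ-sym e)
≈ˢ-sym (≈frame d e) = ≈frame (≈ᵗ-sym d) (≈ˢ-sym e)
≈ᵖ-sym (d ≈∗ e) = ≈ᵗ-sym d ≈∗ ≈ˢ-sym e

≈ᵛ-trans : ∀ {a b c} → a ≈ᵛ b → b ≈ᵛ c → a ≈ᵛ c
≈ᵗ-trans : ∀ {a b c} → a ≈ᵗ b → b ≈ᵗ c → a ≈ᵗ c
≈ˢ-trans : ∀ {a b c} → a ≈ˢ b → b ≈ˢ c → a ≈ˢ c
≈ᵖ-trans : ∀ {a b c} → a ≈ᵖ b → b ≈ᵖ c → a ≈ᵖ c
≈ᵛ-trans (≈var x)      (≈var .x)          = ≈var x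
≈ᵛ-trans (≈lam d)      (≈lam e)           = ≈lam (≈ᵗ-trans d e)
≈ᵛ-trans (≈con c d)    (≈con .c e)        = ≈con c (≈ᵛ-trans d e)
≈ᵛ-trans (≈rec n ls f) (≈rec .n .ls g)    = ≈rec n ls (λ i → ≈ᵛ-trans (f i) (g i))
≈ᵗ-trans (≈tvar a)      (≈tvar .a)        = ≈tvar a
≈ᵗ-trans (≈val d)       (≈val e)          = ≈val (≈ᵛ-trans d e)
≈ᵗ-trans (≈app d d')    (≈app e e')       = ≈app (≈ᵗ-trans d e) (≈ᵗ-trans d' e')
≈ᵗ-trans (≈mu d)        (≈mu e)           = ≈mu (≈ᵗ-trans d e)
≈ᵗ-trans (≈proc d)      (≈proc e)         = ≈proc (≈ᵖ-trans d e)
≈ᵗ-trans (≈proj d l)    (≈proj e .l)      = ≈proj (≈ᵛ-trans d e) l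
≈ᵗ-trans (≈case d n cs f) (≈case e .n .cs g) =
  ≈case (≈ᵛ-trans d e) n cs (λ i → ≈ᵗ-trans (f i) (g i))
≈ᵗ-trans (≈delta d d')  (≈delta e e')     = ≈delta (≈ᵛ-trans d e) (≈ᵛ-trans d' e')
≈ˢ-trans (≈svar α)      (≈svar .α)        = ≈svar α
≈ˢ-trans (≈push d d')   (≈push e e')      = ≈push (≈ᵛ-trans d e) (≈ˢ-trans d' e')
≈ˢ-trans (≈frame d d')  (≈frame e e')     = ≈frame (≈ᵗ-trans d e) (≈ˢ-trans d' e')
≈ᵖ-trans (d ≈∗ d') (e ≈∗ e') = ≈ᵗ-trans d e ≈∗ ≈ˢ-trans d' e'

ren-≈ᵛ : ∀ ρ {v v'} → v ≈ᵛ v' → renV ρ v ≈ᵛ renV ρ v'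
ren-≈ᵗ : ∀ ρ {t t'} → t ≈ᵗ t' → renT ρ t ≈ᵗ renT ρ t'
ren-≈ˢ : ∀ ρ {π π'} → π ≈ˢ π' → renS ρ π ≈ˢ renS ρ π'
ren-≈ᵖ : ∀ ρ {p p'} → p ≈ᵖ p' → renP ρ p ≈ᵖ renP ρ p'
ren-≈ᵛ ρ (≈var x)      = ≈var _
ren-≈ᵛ ρ (≈lam d)      = ≈lam (ren-≈ᵗ (renLam ρ) d)
ren-≈ᵛ ρ (≈con c d)    = ≈con c (ren-≈ᵛ ρ d)
ren-≈ᵛ ρ (≈rec n ls f) = ≈rec n ls (λ i → ren-≈ᵛ ρ (f i))
ren-≈ᵗ ρ (≈tvar a)        = ≈tvar a
ren-≈ᵗ ρ (≈val d)         = ≈val (ren-≈ᵛ ρ d)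
ren-≈ᵗ ρ (≈app d e)       = ≈app (ren-≈ᵗ ρ d) (ren-≈ᵗ ρ e)
ren-≈ᵗ ρ (≈mu d)          = ≈mu (ren-≈ᵗ (renMu ρ) d)
ren-≈ᵗ ρ (≈proc d)        = ≈proc (ren-≈ᵖ ρ d)
ren-≈ᵗ ρ (≈proj d l)      = ≈proj (ren-≈ᵛ ρ d) l
ren-≈ᵗ ρ (≈case d n cs f) = ≈case (ren-≈ᵛ ρ d) n cs (λ i → ren-≈ᵗ (renLam ρ) (f i))
ren-≈ᵗ ρ (≈delta d e)     = ≈delta (ren-≈ᵛ ρ d) (ren-≈ᵛ ρ e)
ren-≈ˢ ρ (≈svar α)    = ≈svar _
ren-≈ˢ ρ (≈push d e)  = ≈push (ren-≈ᵛ ρ d) (ren-≈ˢ ρ e)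
ren-≈ˢ ρ (≈frame d e) = ≈frame (ren-≈ᵗ ρ d) (ren-≈ˢ ρ e)
ren-≈ᵖ ρ (d ≈∗ e) = ren-≈ᵗ ρ d ≈∗ ren-≈ˢ ρ e

record _≈σ_ (σ σ' : Subst) : Set where
  field
    lv≈ : ∀ x → lv σ x ≈ᵛ lv σ' x
    sv≈ : ∀ α → sv σ α ≈ˢ sv σ' α
    tv≈ : ∀ a → tv σ a ≈ᵗ tv σ' a
open _≈σ_

liftLam-≈ : ∀ {σ σ'} → σ ≈σ σ' → liftLam σ ≈σ liftLam σ'
lv≈ (liftLam-≈ q) zero    = ≈var zero
lv≈ (liftLam-≈ q) (suc x) = ren-≈ᵛ wkL (lv≈ q x)
sv≈ (liftLam-≈ q) α       = ren-≈ˢ wkL (sv≈ q α)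
tv≈ (liftLam-≈ q) a       = ren-≈ᵗ wkL (tv≈ q a)

liftMu-≈ : ∀ {σ σ'} → σ ≈σ σ' → liftMu σ ≈σ liftMu σ'
lv≈ (liftMu-≈ q) x       = ren-≈ᵛ wkS (lv≈ q x)
sv≈ (liftMu-≈ q) zero    = ≈svar zero
sv≈ (liftMu-≈ q) (suc α) = ren-≈ˢ wkS (sv≈ q α)
tv≈ (liftMu-≈ q) a       = ren-≈ᵗ wkS (tv≈ q a)

sub-≈ᵛ : ∀ {σ σ'} → σ ≈σ σ' → ∀ {v v'} → v ≈ᵛ v' → subV σ v ≈ᵛ subV σ' v'
sub-≈ᵗ : ∀ {σ σ'} → σ ≈σ σ' → ∀ {t t'} → t ≈ᵗ t' → subT σ t ≈ᵗ subT σ' t'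
sub-≈ˢ : ∀ {σ σ'} → σ ≈σ σ' → ∀ {π π'} → π ≈ˢ π' → subS σ π ≈ˢ subS σ' π'
sub-≈ᵖ : ∀ {σ σ'} → σ ≈σ σ' → ∀ {p p'} → p ≈ᵖ p' → subP σ p ≈ᵖ subP σ' p'
sub-≈ᵛ q (≈var x)      = lv≈ q x
sub-≈ᵛ q (≈lam d)      = ≈lam (sub-≈ᵗ (liftLam-≈ q) d)
sub-≈ᵛ q (≈con c d)    = ≈con c (sub-≈ᵛ q d)
sub-≈ᵛ q (≈rec n ls f) = ≈rec n ls (λ i → sub-≈ᵛ q (f i))
sub-≈ᵗ q (≈tvar a)        = tv≈ q a
sub-≈ᵗ q (≈val d)         = ≈val (sub-≈ᵛ q d)
sub-≈ᵗ q (≈app d e)       = ≈app (sub-≈ᵗ q d) (sub-≈ᵗ q e)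
sub-≈ᵗ q (≈mu d)          = ≈mu (sub-≈ᵗ (liftMu-≈ q) d)
sub-≈ᵗ q (≈proc d)        = ≈proc (sub-≈ᵖ q d)
sub-≈ᵗ q (≈proj d l)      = ≈proj (sub-≈ᵛ q d) l
sub-≈ᵗ q (≈case d n cs f) = ≈case (sub-≈ᵛ q d) n cs (λ i → sub-≈ᵗ (liftLam-≈ q) (f i))
sub-≈ᵗ q (≈delta d e)     = ≈delta (sub-≈ᵛ q d) (sub-≈ᵛ q e)
sub-≈ˢ q (≈svar α)    = sv≈ q α
sub-≈ˢ q (≈push d e)  = ≈push (sub-≈ᵛ q d) (sub-≈ˢ q e)
sub-≈ˢ q (≈frame d e) = ≈frame (sub-≈ᵗ q d) (sub-≈ˢ q e)
sub-≈ᵖ q (d ≈∗ e) = sub-≈ᵗ q d ≈∗ sub-≈ˢ q e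

≈σ-refl : ∀ σ → σ ≈σ σ
lv≈ (≈σ-refl σ) x = ≈ᵛ-refl (lv σ x)
sv≈ (≈σ-refl σ) α = ≈ˢ-refl (sv σ α)
tv≈ (≈σ-refl σ) a = ≈ᵗ-refl (tv σ a)

-- Fusion laws.  Each is stated for an arbitrary triple whose pointwise
-- action composes, so that the induction goes through under binders.

record RenComp (ρ ρ' ρ'' : Ren) : Set where
  field
    lr-comp : ∀ x → lr ρ (lr ρ' x) ≡ lr ρ'' x
    sr-comp : ∀ α → sr ρ (sr ρ' α) ≡ sr ρ'' α
open RenComp

renLam-comp : ∀ {ρ ρ' ρ''} → RenComp ρ ρ' ρ'' → RenComp (renLam ρ) (renLam ρ') (renLam ρ'')
lr-comp (renLam-comp c) zero    = refl
lr-comp (renLam-comp c) (suc x) = cong suc (lr-comp c x)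
sr-comp (renLam-comp c) α       = sr-comp c α

renMu-comp : ∀ {ρ ρ' ρ''} → RenComp ρ ρ' ρ'' → RenComp (renMu ρ) (renMu ρ') (renMu ρ'')
lr-comp (renMu-comp c) x       = lr-comp c x
sr-comp (renMu-comp c) zero    = refl
sr-comp (renMu-comp c) (suc α) = cong suc (sr-comp c α)

ren∘renᵛ : ∀ {ρ ρ' ρ''} → RenComp ρ ρ' ρ'' → ∀ v → renV ρ (renV ρ' v) ≈ᵛ renV ρ'' v
ren∘renᵗ : ∀ {ρ ρ' ρ''} → RenComp ρ ρ' ρ'' → ∀ t → renT ρ (renT ρ' t) ≈ᵗ renT ρ'' t
ren∘renˢ : ∀ {ρ ρ' ρ''} → RenComp ρ ρ' ρ'' → ∀ π → renS ρ (renS ρ' π) ≈ˢ renS ρ'' π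
ren∘renᵖ : ∀ {ρ ρ' ρ''} → RenComp ρ ρ' ρ'' → ∀ p → renP ρ (renP ρ' p) ≈ᵖ renP ρ'' p
ren∘renᵛ c (var x) rewrite lr-comp c x = ≈var _
ren∘renᵛ c (lam t)      = ≈lam (ren∘renᵗ (renLam-comp c) t)
ren∘renᵛ c (con k v)    = ≈con k (ren∘renᵛ c v)
ren∘renᵛ c (rec n ls f) = ≈rec n ls (λ i → ren∘renᵛ c (f i))
ren∘renᵗ c (tvar a)        = ≈tvar a
ren∘renᵗ c (val v)         = ≈val (ren∘renᵛ c v)
ren∘renᵗ c (app t u)       = ≈app (ren∘renᵗ c t) (ren∘renᵗ c u)
ren∘renᵗ c (mu t)          = ≈mu (ren∘renᵗ (renMu-comp c) t)
ren∘renᵗ c (proc p)        = ≈proc (ren∘renᵖ c p)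
ren∘renᵗ c (proj v l)      = ≈proj (ren∘renᵛ c v) l
ren∘renᵗ c (case v n cs f) = ≈case (ren∘renᵛ c v) n cs (λ i → ren∘renᵗ (renLam-comp c) (f i))
ren∘renᵗ c (delta v w)     = ≈delta (ren∘renᵛ c v) (ren∘renᵛ c w)
ren∘renˢ c (svar α) rewrite sr-comp c α = ≈svar _
ren∘renˢ c (push v π)  = ≈push (ren∘renᵛ c v) (ren∘renˢ c π)
ren∘renˢ c (frame t π) = ≈frame (ren∘renᵗ c t) (ren∘renˢ c π)
ren∘renᵖ c (t ∗ π) = ren∘renᵗ c t ≈∗ ren∘renˢ c π

_∘ʳ_ : Ren → Ren → Ren
ρ ∘ʳ ρ' = record { lr = λ x → lr ρ (lr ρ' x) ; sr = λ α → sr ρ (sr ρ' α) }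

∘ʳ-comp : ∀ ρ ρ' → RenComp ρ ρ' (ρ ∘ʳ ρ')
lr-comp (∘ʳ-comp ρ ρ') x = refl
sr-comp (∘ʳ-comp ρ ρ') α = refl

renLam-wkL : ∀ ρ → RenComp (renLam ρ) wkL (wkL ∘ʳ ρ)
lr-comp (renLam-wkL ρ) x = refl
sr-comp (renLam-wkL ρ) α = refl

renMu-wkS : ∀ ρ → RenComp (renMu ρ) wkS (wkS ∘ʳ ρ)
lr-comp (renMu-wkS ρ) x = refl
sr-comp (renMu-wkS ρ) α = refl

record RenSubComp (ρ : Ren) (τ τ'' : Subst) : Set where
  field
    rs-lv : ∀ x → renV ρ (lv τ x) ≈ᵛ lv τ'' x
    rs-sv : ∀ α → renS ρ (sv τ α) ≈ˢ sv τ'' α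
    rs-tv : ∀ a → renT ρ (tv τ a) ≈ᵗ tv τ'' a
open RenSubComp

-- Two factorisations of the same renaming act alike (used with one side
-- being a weakening, to commute it past a renaming).
ren-squareᵛ : ∀ {ρ₁ ρ₂ ρ₃ ρ₄ ρ} → RenComp ρ₁ ρ₂ ρ → RenComp ρ₃ ρ₄ ρ →
  ∀ {v v'} → renV ρ₄ v ≈ᵛ v' → renV ρ₁ (renV ρ₂ v) ≈ᵛ renV ρ₃ v'
ren-squareᵛ {ρ₃ = ρ₃} c c' {v} q =
  ≈ᵛ-trans (ren∘renᵛ c v) (≈ᵛ-trans (≈ᵛ-sym (ren∘renᵛ c' v)) (ren-≈ᵛ ρ₃ q))

ren-squareˢ : ∀ {ρ₁ ρ₂ ρ₃ ρ₄ ρ} → RenComp ρ₁ ρ₂ ρ → RenComp ρ₃ ρ₄ ρ →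
  ∀ {π π'} → renS ρ₄ π ≈ˢ π' → renS ρ₁ (renS ρ₂ π) ≈ˢ renS ρ₃ π'
ren-squareˢ {ρ₃ = ρ₃} c c' {π} q =
  ≈ˢ-trans (ren∘renˢ c π) (≈ˢ-trans (≈ˢ-sym (ren∘renˢ c' π)) (ren-≈ˢ ρ₃ q))

ren-squareᵗ : ∀ {ρ₁ ρ₂ ρ₃ ρ₄ ρ} → RenComp ρ₁ ρ₂ ρ → RenComp ρ₃ ρ₄ ρ →
  ∀ {t t'} → renT ρ₄ t ≈ᵗ t' → renT ρ₁ (renT ρ₂ t) ≈ᵗ renT ρ₃ t'
ren-squareᵗ {ρ₃ = ρ₃} c c' {t} q =
  ≈ᵗ-trans (ren∘renᵗ c t) (≈ᵗ-trans (≈ᵗ-sym (ren∘renᵗ c' t)) (ren-≈ᵗ ρ₃ q))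

renLam-rs : ∀ {ρ τ τ''} → RenSubComp ρ τ τ'' →
  RenSubComp (renLam ρ) (liftLam τ) (liftLam τ'')
rs-lv (renLam-rs c) zero    = ≈var zero
rs-lv (renLam-rs {ρ} c) (suc x) = ren-squareᵛ (renLam-wkL ρ) (∘ʳ-comp wkL ρ) (rs-lv c x)
rs-sv (renLam-rs {ρ} c) α = ren-squareˢ (renLam-wkL ρ) (∘ʳ-comp wkL ρ) (rs-sv c α)
rs-tv (renLam-rs {ρ} c) a = ren-squareᵗ (renLam-wkL ρ) (∘ʳ-comp wkL ρ) (rs-tv c a)

renMu-rs : ∀ {ρ τ τ''} → RenSubComp ρ τ τ'' →
  RenSubComp (renMu ρ) (liftMu τ) (liftMu τ'')
rs-lv (renMu-rs {ρ} c) x = ren-squareᵛ (renMu-wkS ρ) (∘ʳ-comp wkS ρ) (rs-lv c x)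
rs-sv (renMu-rs c) zero  = ≈svar zero
rs-sv (renMu-rs {ρ} c) (suc α) = ren-squareˢ (renMu-wkS ρ) (∘ʳ-comp wkS ρ) (rs-sv c α)
rs-tv (renMu-rs {ρ} c) a = ren-squareᵗ (renMu-wkS ρ) (∘ʳ-comp wkS ρ) (rs-tv c a)

ren∘subᵛ : ∀ {ρ τ τ''} → RenSubComp ρ τ τ'' → ∀ v → renV ρ (subV τ v) ≈ᵛ subV τ'' v
ren∘subᵗ : ∀ {ρ τ τ''} → RenSubComp ρ τ τ'' → ∀ t → renT ρ (subT τ t) ≈ᵗ subT τ'' t
ren∘subˢ : ∀ {ρ τ τ''} → RenSubComp ρ τ τ'' → ∀ π → renS ρ (subS τ π) ≈ˢ subS τ'' π
ren∘subᵖ : ∀ {ρ τ τ''} → RenSubComp ρ τ τ'' → ∀ p → renP ρ (subP τ p) ≈ᵖ subP τ'' p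
ren∘subᵛ c (var x)      = rs-lv c x
ren∘subᵛ c (lam t)      = ≈lam (ren∘subᵗ (renLam-rs c) t)
ren∘subᵛ c (con k v)    = ≈con k (ren∘subᵛ c v)
ren∘subᵛ c (rec n ls f) = ≈rec n ls (λ i → ren∘subᵛ c (f i))
ren∘subᵗ c (tvar a)        = rs-tv c a
ren∘subᵗ c (val v)         = ≈val (ren∘subᵛ c v)
ren∘subᵗ c (app t u)       = ≈app (ren∘subᵗ c t) (ren∘subᵗ c u)
ren∘subᵗ c (mu t)          = ≈mu (ren∘subᵗ (renMu-rs c) t)
ren∘subᵗ c (proc p)        = ≈proc (ren∘subᵖ c p)
ren∘subᵗ c (proj v l)      = ≈proj (ren∘subᵛ c v) l
ren∘subᵗ c (case v n cs f) = ≈case (ren∘subᵛ c v) n cs (λ i → ren∘subᵗ (renLam-rs c) (f i))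
ren∘subᵗ c (delta v w)     = ≈delta (ren∘subᵛ c v) (ren∘subᵛ c w)
ren∘subˢ c (svar α)    = rs-sv c α
ren∘subˢ c (push v π)  = ≈push (ren∘subᵛ c v) (ren∘subˢ c π)
ren∘subˢ c (frame t π) = ≈frame (ren∘subᵗ c t) (ren∘subˢ c π)
ren∘subᵖ c (t ∗ π) = ren∘subᵗ c t ≈∗ ren∘subˢ c π

_ʳ∘_ : Ren → Subst → Subst
ρ ʳ∘ τ = record { lv = λ x → renV ρ (lv τ x) ; sv = λ α → renS ρ (sv τ α) ; tv = λ a → renT ρ (tv τ a) }

ʳ∘-comp : ∀ ρ τ → RenSubComp ρ τ (ρ ʳ∘ τ)
rs-lv (ʳ∘-comp ρ τ) x = ≈ᵛ-refl _
rs-sv (ʳ∘-comp ρ τ) α = ≈ˢ-refl _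
rs-tv (ʳ∘-comp ρ τ) a = ≈ᵗ-refl _

record SubRenComp (σ : Subst) (ρ : Ren) (σ'' : Subst) : Set where
  field
    sr-lv : ∀ x → lv σ (lr ρ x) ≈ᵛ lv σ'' x
    sr-sv : ∀ α → sv σ (sr ρ α) ≈ˢ sv σ'' α
    sr-tv : ∀ a → tv σ a ≈ᵗ tv σ'' a
open SubRenComp

liftLam-sr : ∀ {σ ρ σ''} → SubRenComp σ ρ σ'' → SubRenComp (liftLam σ) (renLam ρ) (liftLam σ'')
sr-lv (liftLam-sr c) zero    = ≈var zero
sr-lv (liftLam-sr c) (suc x) = ren-≈ᵛ wkL (sr-lv c x)
sr-sv (liftLam-sr c) α       = ren-≈ˢ wkL (sr-sv c α)
sr-tv (liftLam-sr c) a       = ren-≈ᵗ wkL (sr-tv c a)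

liftMu-sr : ∀ {σ ρ σ''} → SubRenComp σ ρ σ'' → SubRenComp (liftMu σ) (renMu ρ) (liftMu σ'')
sr-lv (liftMu-sr c) x       = ren-≈ᵛ wkS (sr-lv c x)
sr-sv (liftMu-sr c) zero    = ≈svar zero
sr-sv (liftMu-sr c) (suc α) = ren-≈ˢ wkS (sr-sv c α)
sr-tv (liftMu-sr c) a       = ren-≈ᵗ wkS (sr-tv c a)

sub∘renᵛ : ∀ {σ ρ σ''} → SubRenComp σ ρ σ'' → ∀ v → subV σ (renV ρ v) ≈ᵛ subV σ'' v
sub∘renᵗ : ∀ {σ ρ σ''} → SubRenComp σ ρ σ'' → ∀ t → subT σ (renT ρ t) ≈ᵗ subT σ'' t
sub∘renˢ : ∀ {σ ρ σ''} → SubRenComp σ ρ σ'' → ∀ π → subS σ (renS ρ π) ≈ˢ subS σ'' π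
sub∘renᵖ : ∀ {σ ρ σ''} → SubRenComp σ ρ σ'' → ∀ p → subP σ (renP ρ p) ≈ᵖ subP σ'' p
sub∘renᵛ c (var x)      = sr-lv c x
sub∘renᵛ c (lam t)      = ≈lam (sub∘renᵗ (liftLam-sr c) t)
sub∘renᵛ c (con k v)    = ≈con k (sub∘renᵛ c v)
sub∘renᵛ c (rec n ls f) = ≈rec n ls (λ i → sub∘renᵛ c (f i))
sub∘renᵗ c (tvar a)        = sr-tv c a
sub∘renᵗ c (val v)         = ≈val (sub∘renᵛ c v)
sub∘renᵗ c (app t u)       = ≈app (sub∘renᵗ c t) (sub∘renᵗ c u)
sub∘renᵗ c (mu t)          = ≈mu (sub∘renᵗ (liftMu-sr c) t)
sub∘renᵗ c (proc p)        = ≈proc (sub∘renᵖ c p)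
sub∘renᵗ c (proj v l)      = ≈proj (sub∘renᵛ c v) l
sub∘renᵗ c (case v n cs f) = ≈case (sub∘renᵛ c v) n cs (λ i → sub∘renᵗ (liftLam-sr c) (f i))
sub∘renᵗ c (delta v w)     = ≈delta (sub∘renᵛ c v) (sub∘renᵛ c w)
sub∘renˢ c (svar α)    = sr-sv c α
sub∘renˢ c (push v π)  = ≈push (sub∘renᵛ c v) (sub∘renˢ c π)
sub∘renˢ c (frame t π) = ≈frame (sub∘renᵗ c t) (sub∘renˢ c π)
sub∘renᵖ c (t ∗ π) = sub∘renᵗ c t ≈∗ sub∘renˢ c π

liftLam-wkL : ∀ σ → SubRenComp (liftLam σ) wkL (wkL ʳ∘ σ)
sr-lv (liftLam-wkL σ) x = ≈ᵛ-refl _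
sr-sv (liftLam-wkL σ) α = ≈ˢ-refl _
sr-tv (liftLam-wkL σ) a = ≈ᵗ-refl _

liftMu-wkS : ∀ σ → SubRenComp (liftMu σ) wkS (wkS ʳ∘ σ)
sr-lv (liftMu-wkS σ) x = ≈ᵛ-refl _
sr-sv (liftMu-wkS σ) α = ≈ˢ-refl _
sr-tv (liftMu-wkS σ) a = ≈ᵗ-refl _

record SubComp (σ τ σ'' : Subst) : Set where
  field
    ss-lv : ∀ x → subV σ (lv τ x) ≈ᵛ lv σ'' x
    ss-sv : ∀ α → subS σ (sv τ α) ≈ˢ sv σ'' α
    ss-tv : ∀ a → subT σ (tv τ a) ≈ᵗ tv σ'' a
open SubComp

-- Commuting a weakening ρ past a substitution σ whose lift is σ↑.
lift-squareᵛ : ∀ {σ σ↑ ρ} → SubRenComp σ↑ ρ (ρ ʳ∘ σ) →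
  ∀ v {v'} → subV σ v ≈ᵛ v' → subV σ↑ (renV ρ v) ≈ᵛ renV ρ v'
lift-squareᵛ {σ} {ρ = ρ} c v q =
  ≈ᵛ-trans (sub∘renᵛ c v) (≈ᵛ-trans (≈ᵛ-sym (ren∘subᵛ (ʳ∘-comp ρ σ) v)) (ren-≈ᵛ ρ q))

lift-squareˢ : ∀ {σ σ↑ ρ} → SubRenComp σ↑ ρ (ρ ʳ∘ σ) →
  ∀ π {π'} → subS σ π ≈ˢ π' → subS σ↑ (renS ρ π) ≈ˢ renS ρ π'
lift-squareˢ {σ} {ρ = ρ} c π q =
  ≈ˢ-trans (sub∘renˢ c π) (≈ˢ-trans (≈ˢ-sym (ren∘subˢ (ʳ∘-comp ρ σ) π)) (ren-≈ˢ ρ q))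

lift-squareᵗ : ∀ {σ σ↑ ρ} → SubRenComp σ↑ ρ (ρ ʳ∘ σ) →
  ∀ t {t'} → subT σ t ≈ᵗ t' → subT σ↑ (renT ρ t) ≈ᵗ renT ρ t'
lift-squareᵗ {σ} {ρ = ρ} c t q =
  ≈ᵗ-trans (sub∘renᵗ c t) (≈ᵗ-trans (≈ᵗ-sym (ren∘subᵗ (ʳ∘-comp ρ σ) t)) (ren-≈ᵗ ρ q))

liftLam-ss : ∀ {σ τ σ''} → SubComp σ τ σ'' → SubComp (liftLam σ) (liftLam τ) (liftLam σ'')
ss-lv (liftLam-ss c) zero    = ≈var zero
ss-lv (liftLam-ss {σ} {τ} c) (suc x) = lift-squareᵛ (liftLam-wkL σ) (lv τ x) (ss-lv c x)
ss-sv (liftLam-ss {σ} {τ} c) α = lift-squareˢ (liftLam-wkL σ) (sv τ α) (ss-sv c α)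
ss-tv (liftLam-ss {σ} {τ} c) a = lift-squareᵗ (liftLam-wkL σ) (tv τ a) (ss-tv c a)

liftMu-ss : ∀ {σ τ σ''} → SubComp σ τ σ'' → SubComp (liftMu σ) (liftMu τ) (liftMu σ'')
ss-lv (liftMu-ss {σ} {τ} c) x = lift-squareᵛ (liftMu-wkS σ) (lv τ x) (ss-lv c x)
ss-sv (liftMu-ss c) zero  = ≈svar zero
ss-sv (liftMu-ss {σ} {τ} c) (suc α) = lift-squareˢ (liftMu-wkS σ) (sv τ α) (ss-sv c α)
ss-tv (liftMu-ss {σ} {τ} c) a = lift-squareᵗ (liftMu-wkS σ) (tv τ a) (ss-tv c a)

sub∘subᵛ : ∀ {σ τ σ''} → SubComp σ τ σ'' → ∀ v → subV σ (subV τ v) ≈ᵛ subV σ'' v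
sub∘subᵗ : ∀ {σ τ σ''} → SubComp σ τ σ'' → ∀ t → subT σ (subT τ t) ≈ᵗ subT σ'' t
sub∘subˢ : ∀ {σ τ σ''} → SubComp σ τ σ'' → ∀ π → subS σ (subS τ π) ≈ˢ subS σ'' π
sub∘subᵖ : ∀ {σ τ σ''} → SubComp σ τ σ'' → ∀ p → subP σ (subP τ p) ≈ᵖ subP σ'' p
sub∘subᵛ c (var x)      = ss-lv c x
sub∘subᵛ c (lam t)      = ≈lam (sub∘subᵗ (liftLam-ss c) t)
sub∘subᵛ c (con k v)    = ≈con k (sub∘subᵛ c v)
sub∘subᵛ c (rec n ls f) = ≈rec n ls (λ i → sub∘subᵛ c (f i))
sub∘subᵗ c (tvar a)        = ss-tv c a
sub∘subᵗ c (val v)         = ≈val (sub∘subᵛ c v)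
sub∘subᵗ c (app t u)       = ≈app (sub∘subᵗ c t) (sub∘subᵗ c u)
sub∘subᵗ c (mu t)          = ≈mu (sub∘subᵗ (liftMu-ss c) t)
sub∘subᵗ c (proc p)        = ≈proc (sub∘subᵖ c p)
sub∘subᵗ c (proj v l)      = ≈proj (sub∘subᵛ c v) l
sub∘subᵗ c (case v n cs f) = ≈case (sub∘subᵛ c v) n cs (λ i → sub∘subᵗ (liftLam-ss c) (f i))
sub∘subᵗ c (delta v w)     = ≈delta (sub∘subᵛ c v) (sub∘subᵛ c w)
sub∘subˢ c (svar α)    = ss-sv c α
sub∘subˢ c (push v π)  = ≈push (sub∘subᵛ c v) (sub∘subˢ c π)
sub∘subˢ c (frame t π) = ≈frame (sub∘subᵗ c t) (sub∘subˢ c π)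
sub∘subᵖ c (t ∗ π) = sub∘subᵗ c t ≈∗ sub∘subˢ c π

_∘ˢ_ : Subst → Subst → Subst
σ ∘ˢ τ = record { lv = λ x → subV σ (lv τ x) ; sv = λ α → subS σ (sv τ α) ; tv = λ a → subT σ (tv τ a) }

∘ˢ-comp : ∀ σ τ → SubComp σ τ (σ ∘ˢ τ)
ss-lv (∘ˢ-comp σ τ) x = ≈ᵛ-refl _
ss-sv (∘ˢ-comp σ τ) α = ≈ˢ-refl _
ss-tv (∘ˢ-comp σ τ) a = ≈ᵗ-refl _

record IsIdentity (σ : Subst) : Set where
  field
    id-lv : ∀ x → lv σ x ≈ᵛ var x
    id-sv : ∀ α → sv σ α ≈ˢ svar α
    id-tv : ∀ a → tv σ a ≈ᵗ tvar a
open IsIdentity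

liftLam-id : ∀ {σ} → IsIdentity σ → IsIdentity (liftLam σ)
id-lv (liftLam-id c) zero    = ≈var zero
id-lv (liftLam-id c) (suc x) = ren-≈ᵛ wkL (id-lv c x)
id-sv (liftLam-id c) α       = ren-≈ˢ wkL (id-sv c α)
id-tv (liftLam-id c) a       = ren-≈ᵗ wkL (id-tv c a)

liftMu-id : ∀ {σ} → IsIdentity σ → IsIdentity (liftMu σ)
id-lv (liftMu-id c) x       = ren-≈ᵛ wkS (id-lv c x)
id-sv (liftMu-id c) zero    = ≈svar zero
id-sv (liftMu-id c) (suc α) = ren-≈ˢ wkS (id-sv c α)
id-tv (liftMu-id c) a       = ren-≈ᵗ wkS (id-tv c a)

sub-idᵛ : ∀ {σ} → IsIdentity σ → ∀ v → subV σ v ≈ᵛ v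
sub-idᵗ : ∀ {σ} → IsIdentity σ → ∀ t → subT σ t ≈ᵗ t
sub-idˢ : ∀ {σ} → IsIdentity σ → ∀ π → subS σ π ≈ˢ π
sub-idᵖ : ∀ {σ} → IsIdentity σ → ∀ p → subP σ p ≈ᵖ p
sub-idᵛ c (var x)      = id-lv c x
sub-idᵛ c (lam t)      = ≈lam (sub-idᵗ (liftLam-id c) t)
sub-idᵛ c (con k v)    = ≈con k (sub-idᵛ c v)
sub-idᵛ c (rec n ls f) = ≈rec n ls (λ i → sub-idᵛ c (f i))
sub-idᵗ c (tvar a)        = id-tv c a
sub-idᵗ c (val v)         = ≈val (sub-idᵛ c v)
sub-idᵗ c (app t u)       = ≈app (sub-idᵗ c t) (sub-idᵗ c u)
sub-idᵗ c (mu t)          = ≈mu (sub-idᵗ (liftMu-id c) t)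
sub-idᵗ c (proc p)        = ≈proc (sub-idᵖ c p)
sub-idᵗ c (proj v l)      = ≈proj (sub-idᵛ c v) l
sub-idᵗ c (case v n cs f) = ≈case (sub-idᵛ c v) n cs (λ i → sub-idᵗ (liftLam-id c) (f i))
sub-idᵗ c (delta v w)     = ≈delta (sub-idᵛ c v) (sub-idᵛ c w)
sub-idˢ c (svar α)    = id-sv c α
sub-idˢ c (push v π)  = ≈push (sub-idᵛ c v) (sub-idˢ c π)
sub-idˢ c (frame t π) = ≈frame (sub-idᵗ c t) (sub-idˢ c π)
sub-idᵖ c (t ∗ π) = sub-idᵗ c t ≈∗ sub-idˢ c π

idSubst-id : IsIdentity idSubst
id-lv idSubst-id x = ≈var x
id-sv idSubst-id α = ≈svar α
id-tv idSubst-id a = ≈tvar a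

-- Halting with an explicit number of steps, needed to justify the
-- recursion of the simulation below.

data HaltsIn (D : Val → Val → Set) : ℕ → Proc → Set where
  done : ∀ {p} → Final p → HaltsIn D zero p
  step : ∀ {n p q} → Step D p q → HaltsIn D n q → HaltsIn D (suc n) p

toHaltsIn : ∀ {D p} → Halts (Step D) p → ∃ λ n → HaltsIn D n p
toHaltsIn (q , ε , f) = zero , done f
toHaltsIn (q , s ◅ ss , f) with toHaltsIn (q , ss , f)
... | n , h = suc n , step s h

fromHaltsIn : ∀ {D n p} → HaltsIn D n p → Halts (Step D) p
fromHaltsIn (done f) = _ , ε , f
fromHaltsIn (step s h) with fromHaltsIn h
... | q , ss , f = q , s ◅ ss , f

halts-◅ : ∀ {D p q} → Step D p q → Halts (Step D) q → Halts (Step D) p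
halts-◅ s (r , ss , f) = r , s ◅ ss , f

module ≈-Bisimulation (D : Val → Val → Set)
    (D-≈ : ∀ {v v' w w'} → D v w → v ≈ᵛ v' → w ≈ᵛ w' → D v' w') where

  [0:=]-≈ : ∀ {t t' v v'} → t ≈ᵗ t' → v ≈ᵛ v' → t [0:= v ] ≈ᵗ t' [0:= v' ]
  [0:=]-≈ dt dv = sub-≈ᵗ q dt
    where
    q : _ ≈σ _
    lv≈ q zero    = dv
    lv≈ q (suc x) = ≈var x
    sv≈ q α       = ≈svar α
    tv≈ q a       = ≈tvar a

  [0:=ˢ]-≈ : ∀ {t t' π π'} → t ≈ᵗ t' → π ≈ˢ π' → t [0:=ˢ π ] ≈ᵗ t' [0:=ˢ π' ]
  [0:=ˢ]-≈ dt dπ = sub-≈ᵗ q dt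
    where
    q : _ ≈σ _
    lv≈ q x       = ≈var x
    sv≈ q zero    = dπ
    sv≈ q (suc α) = ≈svar α
    tv≈ q a       = ≈tvar a

  step-≈ : ∀ {p₁ p₂ q₁} → p₁ ≈ᵖ p₂ → Step D p₁ q₁ → ∃ λ q₂ → Step D p₂ q₂ × q₁ ≈ᵖ q₂
  step-≈ (≈app d e ≈∗ s) (base ≻app) = _ , base ≻app , (e ≈∗ ≈frame d s)
  step-≈ (≈val dv ≈∗ ≈frame dt s) (base ≻val) = _ , base ≻val , (dt ≈∗ ≈push dv s)
  step-≈ (≈val (≈lam dt) ≈∗ ≈push dv s) (base ≻lam) = _ , base ≻lam , ([0:=]-≈ dt dv ≈∗ s)
  step-≈ (≈mu dt ≈∗ s) (base ≻mu) = _ , base ≻mu , ([0:=ˢ]-≈ dt s ≈∗ s)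
  step-≈ (≈proc dp ≈∗ s) (base ≻proc) = _ , base ≻proc , dp
  step-≈ (≈proj (≈rec n ls f) _ ≈∗ s) (base (≻proj k)) = _ , base (≻proj k) , (≈val (f k) ≈∗ s)
  step-≈ (≈case (≈con _ dv) n cs f ≈∗ s) (base (≻case k)) =
    _ , base (≻case k) , ([0:=]-≈ (f k) dv ≈∗ s)
  step-≈ (≈delta dv dw ≈∗ s) (δstep d) = _ , δstep (D-≈ d dv dw) , (≈val dv ≈∗ s)

  final-≈ : ∀ {p₁ p₂} → p₁ ≈ᵖ p₂ → Final p₁ → Final p₂
  final-≈ (≈val _ ≈∗ ≈svar _) _ = tt

  haltsIn-≈ : ∀ {n p₁ p₂} → p₁ ≈ᵖ p₂ → HaltsIn D n p₁ → HaltsIn D n p₂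
  haltsIn-≈ e (done f) = done (final-≈ e f)
  haltsIn-≈ e (step s h) with step-≈ e s
  ... | _ , s₂ , e' = step s₂ (haltsIn-≈ e' h)

  halts-≈ : ∀ {p₁ p₂} → p₁ ≈ᵖ p₂ → Halts (Step D) p₁ → Halts (Step D) p₂
  halts-≈ e h = fromHaltsIn (haltsIn-≈ e (proj₂ (toHaltsIn h)))

module Replacement (t₁ t₂ : Term) where

  infix 4 _~ᵛ_ _~ᵗ_ _~ˢ_ _~ᵖ_

  data _~ᵛ_ : Val → Val → Set
  data _~ᵗ_ : Term → Term → Set
  data _~ˢ_ : Stack → Stack → Set
  data _~ᵖ_ : Proc → Proc → Set
  record Related (σ₁ σ₂ : Subst) : Set

  data _~ᵛ_ where
    ~var : ∀ x → var x ~ᵛ var x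
    ~lam : ∀ {t t'} → t ~ᵗ t' → lam t ~ᵛ lam t'
    ~con : ∀ c {v v'} → v ~ᵛ v' → con c v ~ᵛ con c v'
    ~rec : ∀ n ls {f g} → (∀ i → f i ~ᵛ g i) → rec n ls f ~ᵛ rec n ls g

  data _~ᵗ_ where
    ~tvar  : ∀ a → tvar a ~ᵗ tvar a
    ~val   : ∀ {v v'} → v ~ᵛ v' → val v ~ᵗ val v'
    ~app   : ∀ {t t' u u'} → t ~ᵗ t' → u ~ᵗ u' → app t u ~ᵗ app t' u'
    ~mu    : ∀ {t t'} → t ~ᵗ t' → mu t ~ᵗ mu t'
    ~proc  : ∀ {p p'} → p ~ᵖ p' → proc p ~ᵗ proc p'
    ~proj  : ∀ {v v'} → v ~ᵛ v' → ∀ l → proj v l ~ᵗ proj v' l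
    ~case  : ∀ {v v'} → v ~ᵛ v' → ∀ n cs {f g} → (∀ i → f i ~ᵗ g i) →
             case v n cs f ~ᵗ case v' n cs g
    ~delta : ∀ {v v' w w'} → v ~ᵛ v' → w ~ᵛ w' → delta v w ~ᵗ delta v' w'
    hole   : ∀ {u₁ u₂ τ₁ τ₂} → Related τ₁ τ₂ →
             u₁ ≈ᵗ subT τ₁ t₁ → u₂ ≈ᵗ subT τ₂ t₂ → u₁ ~ᵗ u₂

  data _~ˢ_ where
    ~svar  : ∀ α → svar α ~ˢ svar α
    ~push  : ∀ {v v' π π'} → v ~ᵛ v' → π ~ˢ π' → push v π ~ˢ push v' π'
    ~frame : ∀ {t t' π π'} → t ~ᵗ t' → π ~ˢ π' → frame t π ~ˢ frame t' π'

  data _~ᵖ_ where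
    _~∗_ : ∀ {t t' π π'} → t ~ᵗ t' → π ~ˢ π' → (t ∗ π) ~ᵖ (t' ∗ π')

  record Related σ₁ σ₂ where
    inductive
    field
      lv~ : ∀ x → lv σ₁ x ~ᵛ lv σ₂ x
      sv~ : ∀ α → sv σ₁ α ~ˢ sv σ₂ α
      tv~ : ∀ a → tv σ₁ a ~ᵗ tv σ₂ a
  open Related public

  ≈→~ᵛ : ∀ {v v'} → v ≈ᵛ v' → v ~ᵛ v'
  ≈→~ᵗ : ∀ {t t'} → t ≈ᵗ t' → t ~ᵗ t'
  ≈→~ˢ : ∀ {π π'} → π ≈ˢ π' → π ~ˢ π'
  ≈→~ᵖ : ∀ {p p'} → p ≈ᵖ p' → p ~ᵖ p'
  ≈→~ᵛ (≈var x)      = ~var x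
  ≈→~ᵛ (≈lam d)      = ~lam (≈→~ᵗ d)
  ≈→~ᵛ (≈con c d)    = ~con c (≈→~ᵛ d)
  ≈→~ᵛ (≈rec n ls f) = ~rec n ls (λ i → ≈→~ᵛ (f i))
  ≈→~ᵗ (≈tvar a)        = ~tvar a
  ≈→~ᵗ (≈val d)         = ~val (≈→~ᵛ d)
  ≈→~ᵗ (≈app d e)       = ~app (≈→~ᵗ d) (≈→~ᵗ e)
  ≈→~ᵗ (≈mu d)          = ~mu (≈→~ᵗ d)
  ≈→~ᵗ (≈proc d)        = ~proc (≈→~ᵖ d)
  ≈→~ᵗ (≈proj d l)      = ~proj (≈→~ᵛ d) l
  ≈→~ᵗ (≈case d n cs f) = ~case (≈→~ᵛ d) n cs (λ i → ≈→~ᵗ (f i))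
  ≈→~ᵗ (≈delta d e)     = ~delta (≈→~ᵛ d) (≈→~ᵛ e)
  ≈→~ˢ (≈svar α)    = ~svar α
  ≈→~ˢ (≈push d e)  = ~push (≈→~ᵛ d) (≈→~ˢ e)
  ≈→~ˢ (≈frame d e) = ~frame (≈→~ᵗ d) (≈→~ˢ e)
  ≈→~ᵖ (d ≈∗ e) = ≈→~ᵗ d ~∗ ≈→~ˢ e

  ren-~ᵛ : ∀ ρ {v v'} → v ~ᵛ v' → renV ρ v ~ᵛ renV ρ v'
  ren-~ᵗ : ∀ ρ {t t'} → t ~ᵗ t' → renT ρ t ~ᵗ renT ρ t'
  ren-~ˢ : ∀ ρ {π π'} → π ~ˢ π' → renS ρ π ~ˢ renS ρ π'
  ren-~ᵖ : ∀ ρ {p p'} → p ~ᵖ p' → renP ρ p ~ᵖ renP ρ p'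
  ren-~ᵛ ρ (~var x)      = ~var _
  ren-~ᵛ ρ (~lam d)      = ~lam (ren-~ᵗ (renLam ρ) d)
  ren-~ᵛ ρ (~con c d)    = ~con c (ren-~ᵛ ρ d)
  ren-~ᵛ ρ (~rec n ls f) = ~rec n ls (λ i → ren-~ᵛ ρ (f i))
  ren-~ᵗ ρ (~tvar a)        = ~tvar a
  ren-~ᵗ ρ (~val d)         = ~val (ren-~ᵛ ρ d)
  ren-~ᵗ ρ (~app d e)       = ~app (ren-~ᵗ ρ d) (ren-~ᵗ ρ e)
  ren-~ᵗ ρ (~mu d)          = ~mu (ren-~ᵗ (renMu ρ) d)
  ren-~ᵗ ρ (~proc d)        = ~proc (ren-~ᵖ ρ d)
  ren-~ᵗ ρ (~proj d l)      = ~proj (ren-~ᵛ ρ d) l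
  ren-~ᵗ ρ (~case d n cs f) = ~case (ren-~ᵛ ρ d) n cs (λ i → ren-~ᵗ (renLam ρ) (f i))
  ren-~ᵗ ρ (~delta d e)     = ~delta (ren-~ᵛ ρ d) (ren-~ᵛ ρ e)
  ren-~ᵗ ρ (hole {τ₁ = τ₁} {τ₂} r e₁ e₂) =
    hole r' (≈ᵗ-trans (ren-≈ᵗ ρ e₁) (ren∘subᵗ (ʳ∘-comp ρ τ₁) t₁))
            (≈ᵗ-trans (ren-≈ᵗ ρ e₂) (ren∘subᵗ (ʳ∘-comp ρ τ₂) t₂))
    where
    r' : Related (ρ ʳ∘ τ₁) (ρ ʳ∘ τ₂)
    lv~ r' x = ren-~ᵛ ρ (lv~ r x)
    sv~ r' α = ren-~ˢ ρ (sv~ r α)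
    tv~ r' a = ren-~ᵗ ρ (tv~ r a)
  ren-~ˢ ρ (~svar α)    = ~svar _
  ren-~ˢ ρ (~push d e)  = ~push (ren-~ᵛ ρ d) (ren-~ˢ ρ e)
  ren-~ˢ ρ (~frame d e) = ~frame (ren-~ᵗ ρ d) (ren-~ˢ ρ e)
  ren-~ᵖ ρ (d ~∗ e) = ren-~ᵗ ρ d ~∗ ren-~ˢ ρ e

  liftLam-~ : ∀ {σ₁ σ₂} → Related σ₁ σ₂ → Related (liftLam σ₁) (liftLam σ₂)
  lv~ (liftLam-~ r) zero    = ~var zero
  lv~ (liftLam-~ r) (suc x) = ren-~ᵛ wkL (lv~ r x)
  sv~ (liftLam-~ r) α       = ren-~ˢ wkL (sv~ r α)
  tv~ (liftLam-~ r) a       = ren-~ᵗ wkL (tv~ r a)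

  liftMu-~ : ∀ {σ₁ σ₂} → Related σ₁ σ₂ → Related (liftMu σ₁) (liftMu σ₂)
  lv~ (liftMu-~ r) x       = ren-~ᵛ wkS (lv~ r x)
  sv~ (liftMu-~ r) zero    = ~svar zero
  sv~ (liftMu-~ r) (suc α) = ren-~ˢ wkS (sv~ r α)
  tv~ (liftMu-~ r) a       = ren-~ᵗ wkS (tv~ r a)

  sub-~ᵛ : ∀ {σ₁ σ₂} → Related σ₁ σ₂ → ∀ {v v'} → v ~ᵛ v' → subV σ₁ v ~ᵛ subV σ₂ v'
  sub-~ᵗ : ∀ {σ₁ σ₂} → Related σ₁ σ₂ → ∀ {t t'} → t ~ᵗ t' → subT σ₁ t ~ᵗ subT σ₂ t'
  sub-~ˢ : ∀ {σ₁ σ₂} → Related σ₁ σ₂ → ∀ {π π'} → π ~ˢ π' → subS σ₁ π ~ˢ subS σ₂ π'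
  sub-~ᵖ : ∀ {σ₁ σ₂} → Related σ₁ σ₂ → ∀ {p p'} → p ~ᵖ p' → subP σ₁ p ~ᵖ subP σ₂ p'
  sub-~ᵛ r (~var x)      = lv~ r x
  sub-~ᵛ r (~lam d)      = ~lam (sub-~ᵗ (liftLam-~ r) d)
  sub-~ᵛ r (~con c d)    = ~con c (sub-~ᵛ r d)
  sub-~ᵛ r (~rec n ls f) = ~rec n ls (λ i → sub-~ᵛ r (f i))
  sub-~ᵗ r (~tvar a)        = tv~ r a
  sub-~ᵗ r (~val d)         = ~val (sub-~ᵛ r d)
  sub-~ᵗ r (~app d e)       = ~app (sub-~ᵗ r d) (sub-~ᵗ r e)
  sub-~ᵗ r (~mu d)          = ~mu (sub-~ᵗ (liftMu-~ r) d)
  sub-~ᵗ r (~proc d)        = ~proc (sub-~ᵖ r d)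
  sub-~ᵗ r (~proj d l)      = ~proj (sub-~ᵛ r d) l
  sub-~ᵗ r (~case d n cs f) = ~case (sub-~ᵛ r d) n cs (λ i → sub-~ᵗ (liftLam-~ r) (f i))
  sub-~ᵗ r (~delta d e)     = ~delta (sub-~ᵛ r d) (sub-~ᵛ r e)
  sub-~ᵗ {σ₁} {σ₂} r (hole {τ₁ = τ₁} {τ₂} q e₁ e₂) =
    hole q' (≈ᵗ-trans (sub-≈ᵗ (≈σ-refl σ₁) e₁) (sub∘subᵗ (∘ˢ-comp σ₁ τ₁) t₁))
            (≈ᵗ-trans (sub-≈ᵗ (≈σ-refl σ₂) e₂) (sub∘subᵗ (∘ˢ-comp σ₂ τ₂) t₂))
    where
    q' : Related (σ₁ ∘ˢ τ₁) (σ₂ ∘ˢ τ₂)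
    lv~ q' x = sub-~ᵛ r (lv~ q x)
    sv~ q' α = sub-~ˢ r (sv~ q α)
    tv~ q' a = sub-~ᵗ r (tv~ q a)
  sub-~ˢ r (~svar α)    = sv~ r α
  sub-~ˢ r (~push d e)  = ~push (sub-~ᵛ r d) (sub-~ˢ r e)
  sub-~ˢ r (~frame d e) = ~frame (sub-~ᵗ r d) (sub-~ˢ r e)
  sub-~ᵖ r (d ~∗ e) = sub-~ᵗ r d ~∗ sub-~ˢ r e

  Related-refl : ∀ σ → Related σ σ
  lv~ (Related-refl σ) x = ≈→~ᵛ (≈ᵛ-refl _)
  sv~ (Related-refl σ) α = ≈→~ˢ (≈ˢ-refl _)
  tv~ (Related-refl σ) a = ≈→~ᵗ (≈ᵗ-refl _)

  t₁~t₂ : t₁ ~ᵗ t₂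
  t₁~t₂ = hole (Related-refl idSubst) (≈ᵗ-sym (sub-idᵗ idSubst-id t₁))
                                      (≈ᵗ-sym (sub-idᵗ idSubst-id t₂))

  [:=ᵗ]-~ : ∀ E a → E [ a :=ᵗ t₁ ] ~ᵗ E [ a :=ᵗ t₂ ]
  [:=ᵗ]-~ E a = sub-~ᵗ r (≈→~ᵗ (≈ᵗ-refl E))
    where
    updated : ∀ b → updT a t₁ b ~ᵗ updT a t₂ b
    updated b with a ≟ b
    ... | yes _ = t₁~t₂
    ... | no _  = ~tvar b
    r : Related _ _
    lv~ r x = ~var x
    sv~ r α = ~svar α
    tv~ r   = updated

  instance-~ : ∀ {σ₁ σ₂} → Related σ₁ σ₂ → ∀ t → subT σ₁ t ~ᵗ subT σ₂ t
  instance-~ r t = sub-~ᵗ r (≈→~ᵗ (≈ᵗ-refl t))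

  NotHole : ∀ {u₁ u₂} → u₁ ~ᵗ u₂ → Set
  NotHole (hole _ _ _) = ⊥
  NotHole _            = ⊤

  root-view : ∀ t → (∃ λ b → t ≡ tvar b) ⊎
                    (∀ {σ₁ σ₂} (r : Related σ₁ σ₂) → NotHole (instance-~ r t))
  root-view (tvar a)        = inj₁ (a , refl)
  root-view (val v)         = inj₂ (λ r → tt)
  root-view (app t u)       = inj₂ (λ r → tt)
  root-view (mu t)          = inj₂ (λ r → tt)
  root-view (proc p)        = inj₂ (λ r → tt)
  root-view (proj v l)      = inj₂ (λ r → tt)
  root-view (case v n cs f) = inj₂ (λ r → tt)
  root-view (delta v w)     = inj₂ (λ r → tt)

  Preserved : (Val → Val → Set) → Set
  Preserved D = ∀ {v₁ v₂ w₁ w₂} → D v₁ w₁ → v₁ ~ᵛ v₂ → w₁ ~ᵛ w₂ → D v₂ w₂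

module Flip {t₁ t₂ : Term} where
  open Replacement t₁ t₂
  module ~⁻¹ = Replacement t₂ t₁

  flipᵛ : ∀ {v v'} → v ~ᵛ v' → v' ~⁻¹.~ᵛ v
  flipᵗ : ∀ {t t'} → t ~ᵗ t' → t' ~⁻¹.~ᵗ t
  flipˢ : ∀ {π π'} → π ~ˢ π' → π' ~⁻¹.~ˢ π
  flipᵖ : ∀ {p p'} → p ~ᵖ p' → p' ~⁻¹.~ᵖ p
  flipᵛ (~var x)      = ~⁻¹.~var x
  flipᵛ (~lam d)      = ~⁻¹.~lam (flipᵗ d)
  flipᵛ (~con c d)    = ~⁻¹.~con c (flipᵛ d)
  flipᵛ (~rec n ls f) = ~⁻¹.~rec n ls (λ i → flipᵛ (f i))
  flipᵗ (~tvar a)        = ~⁻¹.~tvar a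
  flipᵗ (~val d)         = ~⁻¹.~val (flipᵛ d)
  flipᵗ (~app d e)       = ~⁻¹.~app (flipᵗ d) (flipᵗ e)
  flipᵗ (~mu d)          = ~⁻¹.~mu (flipᵗ d)
  flipᵗ (~proc d)        = ~⁻¹.~proc (flipᵖ d)
  flipᵗ (~proj d l)      = ~⁻¹.~proj (flipᵛ d) l
  flipᵗ (~case d n cs f) = ~⁻¹.~case (flipᵛ d) n cs (λ i → flipᵗ (f i))
  flipᵗ (~delta d e)     = ~⁻¹.~delta (flipᵛ d) (flipᵛ e)
  flipᵗ (hole r e₁ e₂)   = ~⁻¹.hole r' e₂ e₁
    where
    r' : ~⁻¹.Related _ _
    ~⁻¹.lv~ r' x = flipᵛ (lv~ r x)
    ~⁻¹.sv~ r' α = flipˢ (sv~ r α)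
    ~⁻¹.tv~ r' a = flipᵗ (tv~ r a)
  flipˢ (~svar α)    = ~⁻¹.~svar α
  flipˢ (~push d e)  = ~⁻¹.~push (flipᵛ d) (flipˢ e)
  flipˢ (~frame d e) = ~⁻¹.~frame (flipᵗ d) (flipˢ e)
  flipᵖ (d ~∗ e) = flipᵗ d ~⁻¹.~∗ flipˢ e

module Simulation (t₁ t₂ : Term) (D : Val → Val → Set)
    (D-~ : Replacement.Preserved t₁ t₂ D)
    (t₁⇒t₂ : ∀ τ π → Halts (Step D) (subT τ t₁ ∗ π) → Halts (Step D) (subT τ t₂ ∗ π)) where
  open Replacement t₁ t₂
  open ≈-Bisimulation D (λ d ev ew → D-~ d (≈→~ᵛ ev) (≈→~ᵛ ew))

  [0:=]-~ : ∀ {t t' v v'} → t ~ᵗ t' → v ~ᵛ v' → t [0:= v ] ~ᵗ t' [0:= v' ]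
  [0:=]-~ dt dv = sub-~ᵗ r dt
    where
    r : Related _ _
    lv~ r zero    = dv
    lv~ r (suc x) = ~var x
    sv~ r α       = ~svar α
    tv~ r a       = ~tvar a

  [0:=ˢ]-~ : ∀ {t t' π π'} → t ~ᵗ t' → π ~ˢ π' → t [0:=ˢ π ] ~ᵗ t' [0:=ˢ π' ]
  [0:=ˢ]-~ dt dπ = sub-~ᵗ r dt
    where
    r : Related _ _
    lv~ r x       = ~var x
    sv~ r zero    = dπ
    sv~ r (suc α) = ~svar α
    tv~ r a       = ~tvar a

  step-~ : ∀ {u₁ u₂ π₁ π₂ q₁} (d : u₁ ~ᵗ u₂) → NotHole d → π₁ ~ˢ π₂ →
           Step D (u₁ ∗ π₁) q₁ → ∃ λ q₂ → Step D (u₂ ∗ π₂) q₂ × q₁ ~ᵖ q₂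
  step-~ (hole _ _ _) () _ _
  step-~ (~tvar _) _ _ (base ())
  step-~ (~app d e) _ s (base ≻app) = _ , base ≻app , (e ~∗ ~frame d s)
  step-~ (~val dv) _ (~frame dt s) (base ≻val) = _ , base ≻val , (dt ~∗ ~push dv s)
  step-~ (~val (~lam dt)) _ (~push dv s) (base ≻lam) = _ , base ≻lam , ([0:=]-~ dt dv ~∗ s)
  step-~ (~mu dt) _ s (base ≻mu) = _ , base ≻mu , ([0:=ˢ]-~ dt s ~∗ s)
  step-~ (~proc dp) _ s (base ≻proc) = _ , base ≻proc , dp
  step-~ (~proj (~rec n ls f) _) _ s (base (≻proj k)) = _ , base (≻proj k) , (~val (f k) ~∗ s)
  step-~ (~case (~con _ dv) n cs f) _ s (base (≻case k)) =
    _ , base (≻case k) , ([0:=]-~ (f k) dv ~∗ s)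
  step-~ (~delta dv dw) _ s (δstep d) = _ , δstep (D-~ d dv dw) , (~val dv ~∗ s)

  final-~ : ∀ {u₁ u₂ π₁ π₂} (d : u₁ ~ᵗ u₂) → NotHole d → π₁ ~ˢ π₂ →
            Final (u₁ ∗ π₁) → Final (u₂ ∗ π₂)
  final-~ (hole _ _ _) () _ _
  final-~ (~val _) _ (~svar _) _ = tt

  -- By induction on the number of steps and, at a hole, on the relation.
  -- At a hole u₁ ≈ t₁τ₁, u₂ ≈ t₂τ₂: if t₁ is a variable b the hole is the
  -- smaller τ₁ b ~ τ₂ b; otherwise t₁τ₁ ∗ π₁ ~ t₁τ₂ ∗ π₂ with no hole at the
  -- root, and then t₁⇒t₂ moves from t₁τ₂ to t₂τ₂.
  halts-~ : ∀ n {u₁ u₂ π₁ π₂} → u₁ ~ᵗ u₂ → π₁ ~ˢ π₂ →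
            HaltsIn D n (u₁ ∗ π₁) → Halts (Step D) (u₂ ∗ π₂)
  halts-~-root : ∀ n {u₁ u₂ π₁ π₂} (d : u₁ ~ᵗ u₂) → NotHole d → π₁ ~ˢ π₂ →
                 HaltsIn D n (u₁ ∗ π₁) → Halts (Step D) (u₂ ∗ π₂)

  halts-~-root zero d nh s (done f) = _ , ε , final-~ d nh s f
  halts-~-root (suc n) d nh s (step st h) with step-~ d nh s st
  ... | _ , st₂ , (d' ~∗ s') = halts-◅ st₂ (halts-~ n d' s' h)

  halts-~ n {π₁ = π₁} {π₂} (hole {τ₁ = τ₁} {τ₂} r e₁ e₂) s h
    with root-view t₁
  ... | inj₁ (b , refl) =
    halts-≈ (≈ᵗ-sym e₂ ≈∗ ≈ˢ-refl π₂)
      (t₁⇒t₂ τ₂ π₂ (halts-~ n (tv~ r b) s (haltsIn-≈ (e₁ ≈∗ ≈ˢ-refl π₁) h)))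
  ... | inj₂ not-hole =
    halts-≈ (≈ᵗ-sym e₂ ≈∗ ≈ˢ-refl π₂)
      (t₁⇒t₂ τ₂ π₂ (halts-~-root n (instance-~ r t₁) (not-hole r) s
                      (haltsIn-≈ (e₁ ≈∗ ≈ˢ-refl π₁) h)))
  halts-~ n d@(~tvar _)         s h = halts-~-root n d tt s h
  halts-~ n d@(~val _)          s h = halts-~-root n d tt s h
  halts-~ n d@(~app _ _)        s h = halts-~-root n d tt s h
  halts-~ n d@(~mu _)           s h = halts-~-root n d tt s h
  halts-~ n d@(~proc _)         s h = halts-~-root n d tt s h
  halts-~ n d@(~proj _ _)       s h = halts-~-root n d tt s h
  halts-~ n d@(~case _ _ _ _)   s h = halts-~-root n d tt s h
  halts-~ n d@(~delta _ _)      s h = halts-~-root n d tt s h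

  halts-transfer : ∀ {p₁ p₂} → p₁ ~ᵖ p₂ → Halts (Step D) p₁ → Halts (Step D) p₂
  halts-transfer (d ~∗ s) h = halts-~ _ d s (proj₂ (toHaltsIn h))

Conv-sym : ∀ {D t u} → Conv D t u → Conv D u t
Conv-sym c π σ = proj₂ (c π σ) , proj₁ (c π σ)

Conv-trans : ∀ {D t u w} → Conv D t u → Conv D u w → Conv D t w
Conv-trans c d π σ = (λ h → proj₁ (d π σ) (proj₁ (c π σ) h)) ,
                     (λ h → proj₂ (c π σ) (proj₂ (d π σ) h))

≡-sym : ∀ i {t u} → t ≡[ i ] u → u ≡[ i ] t
≡-sym zero    {t} {u} c       = Conv-sym {_} {t} {u} c
≡-sym (suc i) {t} {u} (e , c) = ≡-sym i e , Conv-sym {_} {t} {u} c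

≡-trans : ∀ i {t u w} → t ≡[ i ] u → u ≡[ i ] w → t ≡[ i ] w
≡-trans zero    {t} {u} {w} c       d       = Conv-trans {_} {t} {u} {w} c d
≡-trans (suc i) {t} {u} {w} (e , c) (f , d) = ≡-trans i e f , Conv-trans {_} {t} {u} {w} c d

-- For a δ-predicate preserved by ~ in both directions, Conv passes from
-- t₁, t₂ to all pairs u₁ ~ u₂: their instances u₁σ ∗ π ~ u₂σ ∗ π are
-- related, and the simulation applies in both directions.

Conv-replace : ∀ {D t₁ t₂} → Replacement.Preserved t₁ t₂ D → Replacement.Preserved t₂ t₁ D →
  Conv D t₁ t₂ → ∀ {u₁ u₂} → Replacement._~ᵗ_ t₁ t₂ u₁ u₂ → Conv D u₁ u₂
Conv-replace {D} {t₁} {t₂} D-~ D-~⁻¹ c {u₁} {u₂} d π σ =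
  Simulation.halts-transfer t₁ t₂ D D-~ (λ τ π → proj₁ (c π τ)) related ,
  Simulation.halts-transfer t₂ t₁ D D-~⁻¹ (λ τ π → proj₂ (c π τ)) (Flip.flipᵖ related)
  where
  open Replacement t₁ t₂
  related : (subT σ u₁ ∗ π) ~ᵖ (subT σ u₂ ∗ π)
  related = sub-~ᵗ (Related-refl σ) d ~∗ ≈→~ˢ (≈ˢ-refl π)

-- The replacement theorem, by induction on the level i, simultaneously
-- with preservation of the δ-predicate of ⇝ᵢ: if v₁ ≢ⱼ w₁ for some j < i,
-- then v₂ ≡ⱼ w₂ would give v₁ ≡ⱼ v₂ ≡ⱼ w₂ ≡ⱼ w₁ by the theorem at level j.

replacement : ∀ i {t₁ t₂} → t₁ ≡[ i ] t₂ →
  ∀ {u₁ u₂} → Replacement._~ᵗ_ t₁ t₂ u₁ u₂ → u₁ ≡[ i ] u₂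
Dist-preserved : ∀ i {t₁ t₂} → t₁ ≡[ i ] t₂ → Replacement.Preserved t₁ t₂ (Dist i)

replacement zero {t₁} {t₂} c d =
  Conv-replace (Dist-preserved zero {t₁} {t₂} c) (Dist-preserved zero {t₂} {t₁} (≡-sym zero {t₁} {t₂} c)) c d
replacement (suc i) {t₁} {t₂} e d =
  replacement i (proj₁ e) d ,
  Conv-replace (Dist-preserved (suc i) {t₁} {t₂} e)
               (Dist-preserved (suc i) {t₂} {t₁} (≡-sym (suc i) {t₁} {t₂} e)) (proj₂ e) d

Dist-preserved zero e ()
Dist-preserved (suc i) e (inj₁ x) dv dw = inj₁ (Dist-preserved i (proj₁ e) x dv dw)
Dist-preserved (suc i) {t₁} {t₂} (e , _) (inj₂ v₁≢w₁) dv dw =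
  inj₂ λ v₂≡w₂ → v₁≢w₁
    (≡-trans i (replacement i e (Replacement.~val dv))
      (≡-trans i v₂≡w₂ (replacement i (≡-sym i e) (Replacement.~val (Flip.flipᵛ dw)))))

lemma6 : (t₁ t₂ E : Term) (a : TVar) (k : ℕ) →
    t₁ ≡[ k ] t₂ → (E [ a :=ᵗ t₁ ]) ≡[ k ] (E [ a :=ᵗ t₂ ])
lemma6 t₁ t₂ E a k t₁≡t₂ = replacement k t₁≡t₂ (Replacement.[:=ᵗ]-~ t₁ t₂ E a)
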